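{- Let $U$ be an ultrafilter on $\omega$, let $f:\omega\to\omega$ be unbounded mod $U$ (i.e. for every $k<\omega$, $\{m\mid f(m)\le k\}\notin U$), let $\pi:\omega\to\omega$, $n<\omega$, and $T\subseteq\mathcal{P}(\omega)$ with $|T|\ge n$. If $\diamondsuit^-(U,\pi,f,T)$ holds, then $\pi$ is not bounded by $n$ mod $U$, i.e. $\{m<\omega\mid\pi(m)<n\}\notin U$.
   Context: $\diamondsuit^-(U,\pi,f,T)$ means: there is $\langle\mathcal{A}_m\mid m<\omega\rangle$ with $\mathcal{A}_m\subseteq\mathcal{P}(f(m))$ (where $f(m)=\{0,\dots,f(m)-1\}$) and $|\mathcal{A}_m|\le\pi(m)$, such that for every $X\in T$, $\{m\mid X\cap f(m)\in\mathcal{A}_m\}$ is $U$-positive (equivalently, since $U$ is an ultrafilter, belongs to $U$). -}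

module Defs where

open import Data.Nat using (ℕ; _≤_; _≤ᵇ_; _<ᵇ_)
open import Data.Bool using (Bool; true; false; not; _∧_)
open import Data.Fin using (Fin; toℕ)
open import Data.Fin.Subset using (Subset)
open import Data.Vec using (tabulate)
open import Data.Vec.Properties using (≡-dec)
open import Data.List using (List; length)
open import Data.Product using (Σ; _×_)
open import Data.Sum using (_⊎_)
open import Data.Empty using (⊥)
open import Relation.Nullary using (¬_; does)
open import Relation.Binary.PropositionalEquality using (_≡_; _≢_)
import Data.Bool.Properties as BoolP
import Data.List.Membership.DecPropositional as DecMem

Subsetω : Set
Subsetω = ℕ → Bool

∁ω : Subsetω → Subsetω
∁ω X k = not (X k)

_∩ω_ : Subsetω → Subsetω → Subsetω
(X ∩ω Y) k = X k ∧ Y k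

_⊆ω_ : Subsetω → Subsetω → Set
X ⊆ω Y = ∀ k → X k ≡ true → Y k ≡ true

_≠ω_ : Subsetω → Subsetω → Set
X ≠ω Y = ¬ (∀ k → X k ≡ Y k)

record IsUltrafilter (U : Subsetω → Set) : Set₁ where
  field
    empty∉    : ¬ U (λ _ → false)
    full∈     : U (λ _ → true)
    upward    : ∀ X Y → U X → X ⊆ω Y → U Y
    inter     : ∀ X Y → U X → U Y → U (X ∩ω Y)
    ultra     : ∀ X → U X ⊎ U (∁ω X)

UnboundedMod : (U : Subsetω → Set) → (ℕ → ℕ) → Set
UnboundedMod U f = ∀ k → ¬ U (λ m → f m ≤ᵇ k)

-- X ∩ n, as a subset of n = {0,…,n-1}
restrict : Subsetω → (n : ℕ) → Subset n
restrict X n = tabulate (λ i → X (toℕ i))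

_∈ᵇ_ : ∀ {n} → Subset n → List (Subset n) → Bool
_∈ᵇ_ {n} s A = does (s DM.∈? A)
  where module DM = DecMem (≡-dec BoolP._≟_)

-- ◇⁻(U, π, f, T): there are 𝒜_m ⊆ P(f m) with |𝒜_m| ≤ π m
-- (given as a list of length ≤ π m) such that for every X ∈ T,
-- {m | X ∩ f(m) ∈ 𝒜_m} ∈ U.
DiamondMinus : (U : Subsetω → Set) (π f : ℕ → ℕ) (T : Subsetω → Set) → Set
DiamondMinus U π f T =
  Σ ((m : ℕ) → List (Subset (f m))) λ 𝒜 →
    (∀ m → length (𝒜 m) ≤ π m) ×
    (∀ X → T X → U (λ m → restrict X (f m) ∈ᵇ 𝒜 m))

CardAtLeast : (T : Subsetω → Set) → ℕ → Set
CardAtLeast T n =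
  Σ (Fin n → Subsetω) λ g →
    (∀ i → T (g i)) × (∀ i j → i ≢ j → g i ≠ω g j)

-- Suppose π m < n for U-many m. The n distinct members g₀,…,g_{n-1} of T are
-- pairwise separated by finitely many points, all below some K. Since f is
-- unbounded mod U, U-many m have f m > K, and U-many m have every gᵢ ∩ f m in 𝒜_m.
-- Intersecting these three U-large sets yields some m at which the n pairwise
-- distinct sets gᵢ ∩ f m all lie in 𝒜_m, although |𝒜_m| ≤ π m < n.
-- Constructively, the separating points exist only under a double negation;
-- since the goal is ⊥ this costs nothing.
module Submission where

open import Defs
open import Data.Nat using (ℕ; zero; suc; s≤s; _≤_; _<_; _≤ᵇ_; _<ᵇ_; _⊔_)
open import Data.Nat.Properties
  using (<ᵇ⇒<; ≤⇒≤ᵇ; ≰⇒>; <⇒≤; n≮n; module ≤-Reasoning; ≤-trans; <-≤-trans; m≤m⊔n; m≤n⊔m)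
open import Data.Bool using (true; not; _∧_; T)
import Data.Bool.Properties as Bool
open import Data.Fin using (Fin; toℕ; fromℕ<) renaming (zero to fzero; suc to fsuc)
import Data.Fin.Properties as Fin
open import Data.Fin.Subset using (Subset)
open import Data.Vec using (lookup)
open import Data.Vec.Properties using (lookup∘tabulate; ≡-dec)
open import Data.List using (List; length)
import Data.List as List
open import Data.List.Membership.Propositional using (_∈_)
open import Data.List.Relation.Unary.Any using (index)
open import Data.List.Relation.Unary.Any.Properties using (lookup-index)
import Data.List.Membership.DecPropositional as DecMembership
open import Data.Product using (_×_; _,_; ∃; proj₁; proj₂)
open import Data.Sum using (inj₁; inj₂)
open import Data.Empty using (⊥; ⊥-elim)
open import Function using (_∘_)
open import Function.Bundles using (Equivalence)
open import Function.Definitions using (Injective)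
open import Relation.Nullary using (¬_; yes; no; contradiction)
open import Relation.Nullary.Decidable using (toWitness; decidable-stable; isYes≗does)
open import Relation.Nullary.Negation using (¬¬-map)
open import Relation.Binary.PropositionalEquality using (_≡_; _≢_; refl; trans; cong; module ≡-Reasoning)

¬¬-Π-Fin : ∀ {n} {P : Fin n → Set} → (∀ i → ¬ ¬ P i) → ¬ ¬ (∀ i → P i)
¬¬-Π-Fin {zero}  _  k = k λ ()
¬¬-Π-Fin {suc n} ¬¬P k =
  ¬¬P fzero λ P₀ → ¬¬-Π-Fin (¬¬P ∘ fsuc) λ Pₛ → k λ { fzero → P₀ ; (fsuc i) → Pₛ i }

Fin-bounded : ∀ {n} (F : Fin n → ℕ) → ∃ λ B → ∀ i → F i ≤ B
Fin-bounded {zero}  F = 0 , λ ()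
Fin-bounded {suc n} F with B , F∘fsuc≤B ← Fin-bounded (F ∘ fsuc) =
  F fzero ⊔ B , λ { fzero → m≤m⊔n (F fzero) B ; (fsuc i) → ≤-trans (F∘fsuc≤B i) (m≤n⊔m (F fzero) B) }

Fin-bounded₂ : ∀ {m n} (F : Fin m → Fin n → ℕ) → ∃ λ B → ∀ i j → F i j ≤ B
Fin-bounded₂ F =
  let B , rowBound≤B = Fin-bounded (proj₁ ∘ rowBound)
  in B , λ i j → ≤-trans (proj₂ (rowBound i) j) (rowBound≤B i)
  where
  rowBound : ∀ i → ∃ λ B → ∀ j → F i j ≤ B
  rowBound i = Fin-bounded (F i)

∧≡true⇒ : ∀ {x y} → x ∧ y ≡ true → x ≡ true × y ≡ true
∧≡true⇒ {true} y≡true = refl , y≡true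

not-≤ᵇ⇒> : ∀ m n → not (m ≤ᵇ n) ≡ true → n < m
not-≤ᵇ⇒> m n m≰ᵇn = ≰⇒> λ m≤n → T⇒not≢true (≤⇒≤ᵇ m≤n) m≰ᵇn
  where
  T⇒not≢true : ∀ {b} → T b → not b ≢ true
  T⇒not≢true {true} _ ()

∈ᵇ⇒∈ : ∀ {N} {s : Subset N} {A : List (Subset N)} → s ∈ᵇ A ≡ true → s ∈ A
∈ᵇ⇒∈ {s = s} {A} s∈ᵇA =
  toWitness {a? = s∈?A} (Equivalence.from Bool.T-≡ (trans (isYes≗does s∈?A) s∈ᵇA))
  where
  open DecMembership (≡-dec Bool._≟_) using (_∈?_)
  s∈?A = s ∈? A

injective⇒≤length : ∀ {A : Set} {n} {h : Fin n → A} {xs : List A} →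
  Injective _≡_ _≡_ h → (∀ i → h i ∈ xs) → n ≤ length xs
injective⇒≤length {h = h} {xs} h-inj h∈xs = Fin.injective⇒≤ index-inj
  where
  open ≡-Reasoning
  index-inj : Injective _≡_ _≡_ (index ∘ h∈xs)
  index-inj {i} {j} eq = h-inj (begin
    h i                              ≡⟨ lookup-index (h∈xs i) ⟩
    List.lookup xs (index (h∈xs i))  ≡⟨ cong (List.lookup xs) eq ⟩
    List.lookup xs (index (h∈xs j))  ≡⟨ lookup-index (h∈xs j) ⟨
    h j                              ∎)

lookup-restrict : ∀ X {N k} (k<N : k < N) → lookup (restrict X N) (fromℕ< k<N) ≡ X k
lookup-restrict X k<N =
  trans (lookup∘tabulate (X ∘ toℕ) (fromℕ< k<N)) (cong X (Fin.toℕ-fromℕ< k<N))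

restrict-separates : ∀ X Y {N k} → k < N → X k ≢ Y k → restrict X N ≢ restrict Y N
restrict-separates X Y {k = k} k<N Xk≢Yk XN≡YN = Xk≢Yk (begin
  X k                                    ≡⟨ lookup-restrict X k<N ⟨
  lookup (restrict X _) (fromℕ< k<N)     ≡⟨ cong (λ v → lookup v (fromℕ< k<N)) XN≡YN ⟩
  lookup (restrict Y _) (fromℕ< k<N)     ≡⟨ lookup-restrict Y k<N ⟩
  Y k                                    ∎)
  where open ≡-Reasoning

≠ω⇒¬¬separated : ∀ {X Y} → X ≠ω Y → ¬ ¬ ∃ λ k → X k ≢ Y k
≠ω⇒¬¬separated {X} {Y} X≠Y no-separation =
  X≠Y λ k → decidable-stable (X k Bool.≟ Y k) λ Xk≢Yk → no-separation (k , Xk≢Yk)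

SeparatedBelow : ∀ {n} → ℕ → (Fin n → Subsetω) → Set
SeparatedBelow K g = ∀ {i j} → i ≢ j → ∃ λ k → k < K × g i k ≢ g j k

separatedBelow⇒restrict-injective : ∀ {n K N} {g : Fin n → Subsetω} →
  SeparatedBelow K g → K ≤ N → Injective _≡_ _≡_ (λ i → restrict (g i) N)
separatedBelow⇒restrict-injective {g = g} sep K≤N {i} {j} eq =
  decidable-stable (i Fin.≟ j) λ i≢j →
    let k , k<K , gᵢk≢gⱼk = sep i≢j
    in restrict-separates (g i) (g j) (<-≤-trans k<K K≤N) gᵢk≢gⱼk eq

distinct⇒¬¬separatedBelow : ∀ {n} {g : Fin n → Subsetω} →
  (∀ i j → i ≢ j → g i ≠ω g j) → ¬ ¬ ∃ λ K → SeparatedBelow K g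
distinct⇒¬¬separatedBelow {n} {g} distinct =
  ¬¬-map separatedBelow (¬¬-Π-Fin λ i → ¬¬-Π-Fin λ j → separator i j)
  where
  -- A point (junk 0 when i ≡ j) is chosen for every pair, so the points form a total family that can be bounded.
  Separator : Fin n → Fin n → Set
  Separator i j = ∃ λ k → i ≢ j → g i k ≢ g j k

  separator : ∀ i j → ¬ ¬ Separator i j
  separator i j with i Fin.≟ j
  ... | yes i≡j = λ ¬separator → ¬separator (0 , λ i≢j → contradiction i≡j i≢j)
  ... | no  i≢j = ¬¬-map (λ (k , gᵢk≢gⱼk) → k , λ _ → gᵢk≢gⱼk) (≠ω⇒¬¬separated (distinct i j i≢j))

  separatedBelow : (∀ i j → Separator i j) → ∃ λ K → SeparatedBelow K g
  separatedBelow s =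
    let B , k≤B = Fin-bounded₂ (λ i j → proj₁ (s i j))
    in suc B , λ {i} {j} i≢j → proj₁ (s i j) , s≤s (k≤B i j) , proj₂ (s i j) i≢j

⋂ω : ∀ {n} → (Fin n → Subsetω) → Subsetω
⋂ω {zero}  Z = λ _ → true
⋂ω {suc n} Z = Z fzero ∩ω ⋂ω (Z ∘ fsuc)

⋂ω⊆ : ∀ {n} (Z : Fin n → Subsetω) i → ⋂ω Z ⊆ω Z i
⋂ω⊆ Z fzero    k k∈⋂Z = proj₁ (∧≡true⇒ k∈⋂Z)
⋂ω⊆ Z (fsuc i) k k∈⋂Z = ⋂ω⊆ (Z ∘ fsuc) i k (proj₂ (∧≡true⇒ {Z fzero k} k∈⋂Z))

module Ultrafilter {U : Subsetω → Set} (isUltrafilter : IsUltrafilter U) where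
  open IsUltrafilter isUltrafilter

  ⋂ω∈ : ∀ {n} (Z : Fin n → Subsetω) → (∀ i → U (Z i)) → U (⋂ω Z)
  ⋂ω∈ {zero}  Z _    = full∈
  ⋂ω∈ {suc n} Z Z∈U = inter _ _ (Z∈U fzero) (⋂ω∈ (Z ∘ fsuc) (Z∈U ∘ fsuc))

  ∈⇒¬¬nonempty : ∀ {Y} → U Y → ¬ ¬ ∃ λ m → Y m ≡ true
  ∈⇒¬¬nonempty {Y} Y∈U Y-empty =
    empty∉ (upward Y _ Y∈U λ m Ym → ⊥-elim (Y-empty (m , Ym)))

  unbounded⇒above∈ : ∀ {f} → UnboundedMod U f → ∀ K → U (∁ω λ m → f m ≤ᵇ K)
  unbounded⇒above∈ {f} unbounded K with ultra (λ m → f m ≤ᵇ K)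
  ... | inj₁ f≤K∈U = contradiction f≤K∈U (unbounded K)
  ... | inj₂ f>K∈U = f>K∈U

mainTheorem11 : (U : Subsetω → Set) → IsUltrafilter U →
    (f : ℕ → ℕ) → UnboundedMod U f →
    (π : ℕ → ℕ) (n : ℕ) (T : Subsetω → Set) → CardAtLeast T n →
    DiamondMinus U π f T →
    ¬ U (λ m → π m <ᵇ n)
mainTheorem11 U isUltrafilter f unbounded π n T (g , g∈T , distinct) (𝒜 , |𝒜|≤π , diamond) π<n∈U =
  distinct⇒¬¬separatedBelow distinct λ (K , separated) →
  ∈⇒¬¬nonempty (bad∈U K) λ (m , m∈bad) → no-bad-point separated m m∈bad
  where
  open IsUltrafilter isUltrafilter
  open Ultrafilter isUltrafilter

  guessed : Fin n → Subsetω
  guessed i m = restrict (g i) (f m) ∈ᵇ 𝒜 m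

  bad : ℕ → Subsetω
  bad K = (λ m → π m <ᵇ n) ∩ω ((∁ω λ m → f m ≤ᵇ K) ∩ω ⋂ω guessed)

  bad∈U : ∀ K → U (bad K)
  bad∈U K = inter _ _ π<n∈U (inter _ _ (unbounded⇒above∈ {f} unbounded K)
                                         (⋂ω∈ guessed λ i → diamond (g i) (g∈T i)))

  no-bad-point : ∀ {K} → SeparatedBelow K g → ∀ m → bad K m ≡ true → ⊥
  no-bad-point {K} separated m m∈bad = n≮n n (begin-strict
    n            ≤⟨ injective⇒≤length {xs = 𝒜 m} restrict-injective (λ i → ∈ᵇ⇒∈ (⋂ω⊆ guessed i m m∈⋂)) ⟩
    length (𝒜 m) ≤⟨ |𝒜|≤π m ⟩
    π m          <⟨ <ᵇ⇒< (π m) n (Equivalence.from Bool.T-≡ π<n) ⟩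
    n            ∎)
    where
    open ≤-Reasoning
    π<n : (π m <ᵇ n) ≡ true
    π<n = proj₁ (∧≡true⇒ m∈bad)
    f>K : not (f m ≤ᵇ K) ≡ true
    f>K = proj₁ (∧≡true⇒ (proj₂ (∧≡true⇒ {π m <ᵇ n} m∈bad)))
    m∈⋂ : ⋂ω guessed m ≡ true
    m∈⋂ = proj₂ (∧≡true⇒ {not (f m ≤ᵇ K)} (proj₂ (∧≡true⇒ {π m <ᵇ n} m∈bad)))
    restrict-injective : Injective _≡_ _≡_ (λ i → restrict (g i) (f m))
    restrict-injective = separatedBelow⇒restrict-injective separated (<⇒≤ (not-≤ᵇ⇒> (f m) K f>K))
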